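{- For every integer $l>2$, $\nu_2(16l)\le 6l+10$ and $\nu_3(27l)\le 7l+20$.
   Context: Graphs are finite, simple and undirected; $A_G$ is the adjacency matrix, $I$ the identity, rank over $\mathbb{R}$, $\omega$ the clique number. $\nu_d(n)$ is the minimum of $\operatorname{rank}(A_G+I)$ over all $n$-vertex graphs $G$ with $\omega(G)\le d$. -}

module Defs where

open import Data.Nat using (ℕ; zero; suc)
open import Data.Fin using (Fin; zero; suc; _≟_)
open import Data.Bool using (Bool; true; false; if_then_else_; _∨_)
open import Data.Rational using (ℚ; 0ℚ; 1ℚ; _+_; _*_)
open import Data.Product using (Σ; _×_)
open import Relation.Binary.PropositionalEquality using (_≡_)
open import Relation.Nullary using (¬_; does)
open import Function.Definitions using (Injective)

record Graph (n : ℕ) : Set where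
  field
    adj    : Fin n → Fin n → Bool
    sym    : ∀ i j → adj i j ≡ adj j i
    irrefl : ∀ i → adj i i ≡ false

CliqueNumberAtMost : ∀ {n} → Graph n → ℕ → Set
CliqueNumberAtMost {n} G d =
  ¬ (Σ (Fin (suc d) → Fin n) λ f →
       Injective _≡_ _≡_ f × (∀ a b → ¬ a ≡ b → Graph.adj G (f a) (f b) ≡ true))

adjPlusId : ∀ {n} → Graph n → Fin n → Fin n → ℚ
adjPlusId G i j = if does (i ≟ j) ∨ Graph.adj G i j then 1ℚ else 0ℚ

sumℚ : ∀ {k} → (Fin k → ℚ) → ℚ
sumℚ {zero}  f = 0ℚ
sumℚ {suc k} f = f zero + sumℚ (λ i → f (suc i))

RankAtMost : ∀ {m n} → (Fin m → Fin n → ℚ) → ℕ → Set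
RankAtMost {m} {n} M r =
  Σ (Fin r → Fin m → ℚ) λ B →
    ∀ (j : Fin n) → Σ (Fin r → ℚ) λ c →
      ∀ i → M i j ≡ sumℚ (λ t → c t * B t i)

νAtMost : ℕ → ℕ → ℕ → Set
νAtMost d n k = Σ (Graph n) λ G → CliqueNumberAtMost G d × RankAtMost (adjPlusId G) k

{-# OPTIONS --safe #-}
module Submission where

-- Let H have n vertices, ω(H) ≤ d and rank(I − A_H) ≤ r. In the tensor product G of H with K_l
-- (vertices (t, i), adjacent iff t ~ t′ in H and i ≠ j) the projection to H is a homomorphism,
-- so ω(G) ≤ d, and A_G + I = A_H ⊗ J + (I − A_H) ⊗ I. Subtracting from each row (t, i) the row
-- (t, 0) leaves (I − A_H) ⊗ (I − 𝟏e₀ᵀ), of rank at most r (l − 1), while the subtracted rows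
-- span at most n dimensions; hence rank(A_G + I) ≤ n + r (l − 1).
--
-- For H take the intersection graphs of the 16 lines on a quartic del Pezzo surface (the
-- Clebsch graph, triangle-free) and of the 27 lines on a cubic surface (the complement of the
-- Schläfli graph, K₄-free). Lines have self-intersection −1 and distinct lines meet at most
-- once, so I − A_H is minus the Gram matrix of their classes in the Picard lattice ℤ^{1,5},
-- resp. ℤ^{1,6}, and has rank at most 6, resp. 7.

open import Defs
open import Data.Nat using (ℕ; _<_; _*_; _+_)
open import Data.Product using (_×_)

open import Algebra.Bundles using (CommutativeRing)
import Algebra.Properties.CommutativeSemigroup as CommSemigroupProperties
open import Data.Bool using (Bool; true; false; if_then_else_; not; _∧_)
import Data.Bool.Properties as Bool
open import Data.Fin using (Fin; zero; suc; _≟_; _↑ˡ_; _↑ʳ_; splitAt; combine; remQuot; quotient; remainder)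
open import Data.Fin.Patterns using (0F; 1F; 2F; 3F; 4F; 5F)
open import Data.Fin.Properties using (suc-injective; remQuot-combine; combine-remQuot; all?; any?)
open import Data.Integer as ℤ using (ℤ)
import Data.Integer.Properties as ℤ
import Data.Integer.Solver as ℤ
open import Algebra.Properties.Semiring.Sum ℤ.+-*-semiring using (*-distribˡ-sum)
  renaming (sum to sumℤ; sum-cong-≗ to sumℤ-cong)
open import Data.List using (List; []; _∷_)
open import Data.List.Relation.Unary.All as All using (All; []; _∷_)
open import Data.Nat using (zero; suc)
import Data.Nat.Solver as ℕ
open import Data.Product using (∃; _,_; proj₁; proj₂; uncurry)
open import Data.Rational as ℚ using (ℚ; 0ℚ; 1ℚ)
open import Data.Rational.Literals using (fromℤ)
import Data.Rational.Properties as ℚ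
open import Data.Rational.Solver using (module +-*-Solver)
open import Data.Sum using (_⊎_; inj₁; inj₂; [_,_]′)
import Data.Sum as Sum
open import Data.Unit using (⊤; tt)
open import Data.Vec using (Vec; []; _∷_; lookup)
open import Data.Vec.Functional using (Vector) renaming (_∷_ to _◂_)
open import Function using (_∘_; case_of_)
open import Function.Definitions using (Injective)
open import Relation.Binary.PropositionalEquality
  using (_≡_; _≢_; refl; sym; trans; cong; cong₂; subst; module ≡-Reasoning)
open import Relation.Nullary using (Dec; yes; no; does; ¬_; ¬?; _×-dec_; _⊎-dec_; _→-dec_; contradiction)
open import Relation.Nullary.Decidable using (dec-true; dec-false; from-yes; from-no)

private
  variable
    m n m′ n′ r s : ℕ

𝟙 : Bool → ℚ
𝟙 b = if b then 1ℚ else 0ℚ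

δ : Fin n → Fin n → ℚ
δ i j = 𝟙 (does (i ≟ j))

δ-refl : (i : Fin n) → δ i i ≡ 1ℚ
δ-refl i = cong 𝟙 (dec-true (i ≟ i) refl)

δ-≢ : {i j : Fin n} → i ≢ j → δ i j ≡ 0ℚ
δ-≢ {i = i} {j} i≢j = cong 𝟙 (dec-false (i ≟ j) i≢j)

Matrix : ℕ → ℕ → Set
Matrix m n = Fin m → Fin n → ℚ

J : Matrix m n
J _ _ = 1ℚ

_+ᴹ_ : Matrix m n → Matrix m n → Matrix m n
(M +ᴹ N) i j = M i j ℚ.+ N i j

-- The index v : Fin (m * m′) stands for the pair (quotient m′ v , remainder m′ v).
_⊗_ : Matrix m n → Matrix m′ n′ → Matrix (m * m′) (n * n′)
_⊗_ {m} {n} {m′} {n′} M N v w =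
  M (quotient {m} m′ v) (quotient {n} n′ w) ℚ.* N (remainder {m} m′ v) (remainder {n} n′ w)

sumℚ-cong : {f g : Fin n → ℚ} → (∀ i → f i ≡ g i) → sumℚ f ≡ sumℚ g
sumℚ-cong {zero}  f≗g = refl
sumℚ-cong {suc n} f≗g = cong₂ ℚ._+_ (f≗g zero) (sumℚ-cong (f≗g ∘ suc))

sumℚ-*ˡ : ∀ a (f : Fin n → ℚ) → sumℚ (λ i → a ℚ.* f i) ≡ a ℚ.* sumℚ f
sumℚ-*ˡ {zero}  a f = sym (ℚ.*-zeroʳ a)
sumℚ-*ˡ {suc n} a f = trans (cong (a ℚ.* f zero ℚ.+_) (sumℚ-*ˡ a (f ∘ suc)))
                            (sym (ℚ.*-distribˡ-+ a (f zero) _))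

sumℚ-*ʳ : ∀ a (f : Fin n → ℚ) → sumℚ (λ i → f i ℚ.* a) ≡ sumℚ f ℚ.* a
sumℚ-*ʳ {zero}  a f = sym (ℚ.*-zeroˡ a)
sumℚ-*ʳ {suc n} a f = trans (cong (f zero ℚ.* a ℚ.+_) (sumℚ-*ʳ a (f ∘ suc)))
                            (sym (ℚ.*-distribʳ-+ a (f zero) _))

sumℚ-*0 : (f : Fin n → ℚ) → sumℚ (λ i → f i ℚ.* 0ℚ) ≡ 0ℚ
sumℚ-*0 f = trans (sumℚ-*ʳ 0ℚ f) (ℚ.*-zeroʳ (sumℚ f))

sumℚ-*-sumℚ : (f : Fin m → ℚ) (g : Fin n → ℚ) →
              sumℚ f ℚ.* sumℚ g ≡ sumℚ (λ i → sumℚ (λ j → f i ℚ.* g j))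
sumℚ-*-sumℚ f g = trans (sym (sumℚ-*ʳ (sumℚ g) f)) (sumℚ-cong λ i → sym (sumℚ-*ˡ (f i) g))

sumℚ-*δ : (f : Fin n → ℚ) (i : Fin n) → sumℚ (λ k → f k ℚ.* δ k i) ≡ f i
sumℚ-*δ {suc n} f zero = begin
  f zero ℚ.* 1ℚ ℚ.+ sumℚ (λ k → f (suc k) ℚ.* 0ℚ)  ≡⟨ cong₂ ℚ._+_ (ℚ.*-identityʳ (f zero)) (sumℚ-*0 (f ∘ suc)) ⟩
  f zero ℚ.+ 0ℚ                                   ≡⟨ ℚ.+-identityʳ (f zero) ⟩
  f zero                                          ∎
  where open ≡-Reasoning
sumℚ-*δ {suc n} f (suc i) = begin
  f zero ℚ.* 0ℚ ℚ.+ sumℚ (λ k → f (suc k) ℚ.* δ k i)  ≡⟨ cong₂ ℚ._+_ (ℚ.*-zeroʳ (f zero)) (sumℚ-*δ (f ∘ suc) i) ⟩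
  0ℚ ℚ.+ f (suc i)                                   ≡⟨ ℚ.+-identityˡ (f (suc i)) ⟩
  f (suc i)                                          ∎
  where open ≡-Reasoning

sumℚ-splitAt : ∀ m (f : Fin m ⊎ Fin n → ℚ) → sumℚ (f ∘ splitAt m) ≡ sumℚ (f ∘ inj₁) ℚ.+ sumℚ (f ∘ inj₂)
sumℚ-splitAt zero    f = sym (ℚ.+-identityˡ _)
sumℚ-splitAt (suc m) f = trans (cong (f (inj₁ zero) ℚ.+_) (sumℚ-splitAt m (f ∘ Sum.map₁ suc)))
                               (sym (ℚ.+-assoc (f (inj₁ zero)) _ _))

sumℚ-↑ : ∀ m (f : Fin (m + n) → ℚ) → sumℚ f ≡ sumℚ (λ i → f (i ↑ˡ n)) ℚ.+ sumℚ (λ j → f (m ↑ʳ j))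
sumℚ-↑ zero    f = sym (ℚ.+-identityˡ _)
sumℚ-↑ (suc m) f = trans (cong (f zero ℚ.+_) (sumℚ-↑ m (f ∘ suc))) (sym (ℚ.+-assoc (f zero) _ _))

sumℚ-combine : ∀ m (f : Fin (m * n) → ℚ) → sumℚ f ≡ sumℚ (λ i → sumℚ (λ j → f (combine {m} {n} i j)))
sumℚ-combine zero        f = refl
sumℚ-combine {n} (suc m) f =
  trans (sumℚ-↑ n f) (cong (sumℚ (λ j → f (j ↑ˡ (m * n))) ℚ.+_) (sumℚ-combine m (λ u → f (n ↑ʳ u))))

sumℚ-remQuot : ∀ m (f : Fin m × Fin n → ℚ) → sumℚ (f ∘ remQuot {m} n) ≡ sumℚ (λ i → sumℚ (λ j → f (i , j)))
sumℚ-remQuot m f = trans (sumℚ-combine m _) (sumℚ-cong λ i → sumℚ-cong λ j → cong f (remQuot-combine i j))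

RankAtMost-cong : {M N : Matrix m n} → (∀ i j → M i j ≡ N i j) → RankAtMost M r → RankAtMost N r
RankAtMost-cong M≗N (B , span) = B , λ j →
  proj₁ (span j) , λ i → trans (sym (M≗N i j)) (proj₂ (span j) i)

RankAtMost-rows : (M : Matrix m n) → RankAtMost M m
RankAtMost-rows M = δ , λ j → (λ t → M t j) , λ i → sym (sumℚ-*δ (λ t → M t j) i)

RankAtMost-reindexRows : {M : Matrix m n} (ρ : Fin m′ → Fin m) → RankAtMost M r → RankAtMost (M ∘ ρ) r
RankAtMost-reindexRows ρ (B , span) = (λ k → B k ∘ ρ) , λ j → proj₁ (span j) , proj₂ (span j) ∘ ρ

RankAtMost-zeroRow : (M : Matrix (suc m) n) → (∀ j → M zero j ≡ 0ℚ) → RankAtMost M m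
RankAtMost-zeroRow M M₀≡0 = δ ∘ suc , λ j → (λ k → M (suc k) j) , λ where
  zero    → trans (M₀≡0 j) (sym (sumℚ-*0 (λ k → M (suc k) j)))
  (suc i) → sym (sumℚ-*δ (λ k → M (suc k) j) i)

RankAtMost-+ : {M N : Matrix m n} → RankAtMost M r → RankAtMost N s → RankAtMost (M +ᴹ N) (r + s)
RankAtMost-+ {r = r} (B , spanM) (C , spanN) = (λ u → [ B , C ]′ (splitAt r u)) , λ j →
  let (c , eqM) = spanM j ; (d , eqN) = spanN j in
  (λ u → [ c , d ]′ (splitAt r u)) , λ i →
  trans (cong₂ ℚ._+_ (eqM i) (eqN i)) (sym (sumℚ-splitAt r (λ x → [ c , d ]′ x ℚ.* [ B , C ]′ x i)))

RankAtMost-⊗ : {M : Matrix m n} {N : Matrix m′ n′} → RankAtMost M r → RankAtMost N s → RankAtMost (M ⊗ N) (r * s)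
RankAtMost-⊗ {m} {n} {m′} {n′} {r} {s} {M} {N} (B , spanM) (C , spanN) = B ⊗ C , λ w →
  let (c , eqM) = spanM (quotient {n} n′ w) ; (d , eqN) = spanN (remainder {n} n′ w) in
  (λ u → c (quotient {r} s u) ℚ.* d (remainder {r} s u)) , λ v →
  let t = quotient {m} m′ v ; i = remainder {m} m′ v in begin
    (M ⊗ N) v w
      ≡⟨ cong₂ ℚ._*_ (eqM t) (eqN i) ⟩
    sumℚ (λ k → c k ℚ.* B k t) ℚ.* sumℚ (λ l → d l ℚ.* C l i)
      ≡⟨ sumℚ-*-sumℚ (λ k → c k ℚ.* B k t) (λ l → d l ℚ.* C l i) ⟩
    sumℚ (λ k → sumℚ (λ l → (c k ℚ.* B k t) ℚ.* (d l ℚ.* C l i)))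
      ≡⟨ sumℚ-cong (λ k → sumℚ-cong (λ l → *-interchange (c k) (B k t) (d l) (C l i))) ⟩
    sumℚ (λ k → sumℚ (λ l → (c k ℚ.* d l) ℚ.* (B k t ℚ.* C l i)))
      ≡⟨ sym (sumℚ-remQuot r (λ (k , l) → (c k ℚ.* d l) ℚ.* (B k t ℚ.* C l i))) ⟩
    sumℚ (λ u → (c (quotient {r} s u) ℚ.* d (remainder {r} s u)) ℚ.* (B ⊗ C) u v) ∎
  where
  open ≡-Reasoning
  open CommSemigroupProperties (CommutativeRing.*-commutativeSemigroup ℚ.+-*-commutativeRing)
    renaming (interchange to *-interchange)

RankAtMost-⊗J+⊗δ : (A P : Matrix n n′) → RankAtMost P r → ∀ l →
                   RankAtMost ((A ⊗ J {suc l} {suc l}) +ᴹ (P ⊗ δ)) (n + r * l)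
RankAtMost-⊗J+⊗δ {n} {n′} A P rankP l =
  RankAtMost-cong (λ v w → sym (splitRows v w))
    (RankAtMost-+ (RankAtMost-reindexRows (quotient {n} (suc l)) (RankAtMost-rows firstBlockRow))
                  (RankAtMost-⊗ rankP (RankAtMost-zeroRow E λ j → ℚ.+-inverseʳ (δ zero j))))
  where
  E : Matrix (suc l) (suc l)
  E i j = δ i j ℚ.- δ zero j
  firstBlockRow : Matrix n (n′ * suc l)
  firstBlockRow t w = let t′ = quotient {n′} (suc l) w ; j = remainder {n′} (suc l) w in
    A t t′ ℚ.* 1ℚ ℚ.+ P t t′ ℚ.* δ zero j
  splitRows : ∀ v w → ((A ⊗ J) +ᴹ (P ⊗ δ)) v w ≡ (firstBlockRow ∘ quotient {n} (suc l)) v w ℚ.+ (P ⊗ E) v w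
  splitRows v w =
    solve 4 (λ a p x y → a :* con 1ℚ :+ p :* x := (a :* con 1ℚ :+ p :* y) :+ p :* (x :- y)) refl
          (A t t′) (P t t′) (δ i j) (δ zero j)
    where
    open +-*-Solver
    t  = quotient {n} (suc l) v
    t′ = quotient {n′} (suc l) w
    i  = remainder {n} (suc l) v
    j  = remainder {n′} (suc l) w

-- The tensor product with a complete graph

adjMatrix : Graph n → Matrix n n
adjMatrix G i j = 𝟙 (Graph.adj G i j)

idMinusAdj : Graph n → Matrix n n
idMinusAdj G i j = δ i j ℚ.- adjMatrix G i j

adjPlusId≡δ+adjMatrix : (G : Graph n) → ∀ i j → adjPlusId G i j ≡ δ i j ℚ.+ adjMatrix G i j
adjPlusId≡δ+adjMatrix G i j with i ≟ j
... | yes refl rewrite Graph.irrefl G i = refl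
... | no _     = sym (ℚ.+-identityˡ _)

remQuot-injective : {v w : Fin (m * n)} → remQuot {m} n v ≡ remQuot n w → v ≡ w
remQuot-injective {m} {n} {v} {w} eq = begin
  v                                 ≡⟨ sym (combine-remQuot {m} n v) ⟩
  uncurry combine (remQuot {m} n v) ≡⟨ cong (uncurry combine) eq ⟩
  uncurry combine (remQuot {m} n w) ≡⟨ combine-remQuot {m} n w ⟩
  w                                 ∎
  where open ≡-Reasoning

δ≡δ⊗δ : (v w : Fin (m * n)) → δ v w ≡ (δ {m} ⊗ δ {n}) v w
δ≡δ⊗δ {m} {n} v w = case v ≟ w of λ where
    (yes refl) → trans (δ-refl v) (sym (cong₂ ℚ._*_ (δ-refl t) (δ-refl i)))
    (no v≢w)   → trans (δ-≢ v≢w) (sym (δ⊗δ-≢ v≢w))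
  where
  t  = quotient {m} n v
  t′ = quotient {m} n w
  i  = remainder {m} n v
  i′ = remainder {m} n w
  δ⊗δ-≢ : v ≢ w → δ t t′ ℚ.* δ i i′ ≡ 0ℚ
  δ⊗δ-≢ v≢w = case t ≟ t′ of λ where
    (no t≢t′)  → trans (cong (ℚ._* δ i i′) (δ-≢ t≢t′)) (ℚ.*-zeroˡ (δ i i′))
    (yes t≡t′) → trans (cong (δ t t′ ℚ.*_) (δ-≢ λ i≡i′ → v≢w (remQuot-injective {m} (cong₂ _,_ t≡t′ i≡i′))))
                       (ℚ.*-zeroʳ (δ t t′))

does-≟-sym : (i j : Fin n) → does (i ≟ j) ≡ does (j ≟ i)
does-≟-sym i j = case i ≟ j of λ where
  (yes i≡j) → trans (dec-true (i ≟ j) i≡j) (sym (dec-true (j ≟ i) (sym i≡j)))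
  (no i≢j)  → trans (dec-false (i ≟ j) i≢j) (sym (dec-false (j ≟ i) (i≢j ∘ sym)))

_⊗K_ : Graph n → (l : ℕ) → Graph (n * l)
_⊗K_ {n} H l = record
  { adj    = λ v w → not (does (block v ≟ block w)) ∧ Graph.adj H (vertex v) (vertex w)
  ; sym    = λ v w → cong₂ (λ b c → not b ∧ c) (does-≟-sym (block v) (block w)) (Graph.sym H (vertex v) (vertex w))
  ; irrefl = λ v → cong (λ b → not b ∧ Graph.adj H (vertex v) (vertex v)) (dec-true (block v ≟ block v) refl)
  }
  where
  vertex = quotient {n} l
  block  = remainder {n} l

𝟙-not-∧ : ∀ b c → 𝟙 (not b ∧ c) ≡ 𝟙 c ℚ.* (1ℚ ℚ.- 𝟙 b)
𝟙-not-∧ false false = refl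
𝟙-not-∧ false true  = refl
𝟙-not-∧ true  false = refl
𝟙-not-∧ true  true  = refl

adjPlusId-⊗K : (H : Graph n) (l : ℕ) → ∀ v w →
               adjPlusId (H ⊗K l) v w ≡ ((adjMatrix H ⊗ J) +ᴹ (idMinusAdj H ⊗ δ)) v w
adjPlusId-⊗K {n} H l v w = begin
  adjPlusId (H ⊗K l) v w
    ≡⟨ adjPlusId≡δ+adjMatrix (H ⊗K l) v w ⟩
  δ v w ℚ.+ adjMatrix (H ⊗K l) v w
    ≡⟨ cong₂ ℚ._+_ (δ≡δ⊗δ {n} v w) (𝟙-not-∧ (does (i ≟ i′)) (Graph.adj H t t′)) ⟩
  δ t t′ ℚ.* δ i i′ ℚ.+ a ℚ.* (1ℚ ℚ.- δ i i′)
    ≡⟨ solve 3 (λ d e a → d :* e :+ a :* (con 1ℚ :- e) := a :* con 1ℚ :+ (d :- a) :* e) refl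
               (δ t t′) (δ i i′) a ⟩
  a ℚ.* 1ℚ ℚ.+ (δ t t′ ℚ.- a) ℚ.* δ i i′
    ∎
  where
  open ≡-Reasoning
  open +-*-Solver
  t  = quotient {n} l v
  t′ = quotient {n} l w
  i  = remainder {n} l v
  i′ = remainder {n} l w
  a  = adjMatrix H t t′

RankAtMost-adjPlusId-⊗K : (H : Graph n) → RankAtMost (idMinusAdj H) r → ∀ l →
                          RankAtMost (adjPlusId (H ⊗K suc l)) (n + r * l)
RankAtMost-adjPlusId-⊗K H rank l =
  RankAtMost-cong (λ v w → sym (adjPlusId-⊗K H (suc l) v w))
                  (RankAtMost-⊗J+⊗δ (adjMatrix H) (idMinusAdj H) rank l)

CliqueNumberAtMost-hom : ∀ {d} {G : Graph m} {H : Graph n} (h : Fin m → Fin n) →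
                         (∀ v w → Graph.adj G v w ≡ true → Graph.adj H (h v) (h w) ≡ true) →
                         CliqueNumberAtMost H d → CliqueNumberAtMost G d
CliqueNumberAtMost-hom {H = H} h hom ωH≤d (f , _ , f-clique) =
  ωH≤d (h ∘ f , h∘f-injective , λ a b a≢b → hom (f a) (f b) (f-clique a b a≢b))
  where
  h∘f-injective : Injective _≡_ _≡_ (h ∘ f)
  h∘f-injective {a} {b} hfa≡hfb = case a ≟ b of λ where
    (yes a≡b) → a≡b
    (no a≢b)  → contradiction
      (trans (sym (Graph.irrefl H (h (f b))))
             (subst (λ x → Graph.adj H x (h (f b)) ≡ true) hfa≡hfb (hom _ _ (f-clique a b a≢b))))
      λ ()

νAtMost-⊗K : ∀ {d} (H : Graph n) → CliqueNumberAtMost H d → RankAtMost (idMinusAdj H) r → ∀ l →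
             νAtMost d (n * suc l) (n + r * l)
νAtMost-⊗K {n} H ωH≤d rank l =
  H ⊗K suc l ,
  CliqueNumberAtMost-hom {G = H ⊗K suc l} {H = H} (quotient {n} (suc l)) (λ v w → Bool.∧-conicalʳ _ _) ωH≤d ,
  RankAtMost-adjPlusId-⊗K H rank l

HasClique : Graph n → ℕ → List (Fin n) → Set
HasClique G zero    xs = ⊤
HasClique G (suc k) xs = ∃ λ v → All (λ u → Graph.adj G v u ≡ true) xs × HasClique G k (v ∷ xs)

hasClique? : (G : Graph n) → ∀ k xs → Dec (HasClique G k xs)
hasClique? G zero    xs = yes tt
hasClique? G (suc k) xs =
  any? λ v → All.all? (λ u → Graph.adj G v u Bool.≟ true) xs ×-dec hasClique? G k (v ∷ xs)

clique⇒HasClique : ∀ {k xs} (G : Graph n) (f : Fin k → Fin n) →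
                   (∀ a b → a ≢ b → Graph.adj G (f a) (f b) ≡ true) →
                   (∀ a → All (λ u → Graph.adj G (f a) u ≡ true) xs) → HasClique G k xs
clique⇒HasClique {k = zero}  G f clique adjXs = tt
clique⇒HasClique {k = suc k} G f clique adjXs =
  f zero , adjXs zero ,
  clique⇒HasClique G (f ∘ suc) (λ a b a≢b → clique (suc a) (suc b) (a≢b ∘ suc-injective))
                               (λ a → clique (suc a) zero (λ ()) ∷ adjXs (suc a))

¬HasClique⇒CliqueNumberAtMost : ∀ {d} (G : Graph n) → ¬ HasClique G (suc d) [] → CliqueNumberAtMost G d
¬HasClique⇒CliqueNumberAtMost G noClique (f , _ , clique) = noClique (clique⇒HasClique G f clique (λ _ → []))

-- Lines on del Pezzo surfaces

fromℤ-+ : ∀ a b → fromℤ (a ℤ.+ b) ≡ fromℤ a ℚ.+ fromℤ b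
fromℤ-+ a b = sym (begin
  fromℤ a ℚ.+ fromℤ b  ≡⟨ cong (ℚ._/ 1) (cong₂ ℤ._+_ (ℤ.*-identityʳ a) (ℤ.*-identityʳ b)) ⟩
  (a ℤ.+ b) ℚ./ 1     ≡⟨ ℚ.fromℚᵘ-toℚᵘ (fromℤ (a ℤ.+ b)) ⟩
  fromℤ (a ℤ.+ b)      ∎)
  where open ≡-Reasoning

fromℤ-* : ∀ a b → fromℤ (a ℤ.* b) ≡ fromℤ a ℚ.* fromℤ b
fromℤ-* a b = sym (ℚ.fromℚᵘ-toℚᵘ (fromℤ (a ℤ.* b)))

fromℤ-sum : (f : Fin n → ℤ) → fromℤ (sumℤ f) ≡ sumℚ (fromℤ ∘ f)
fromℤ-sum {zero}  f = refl
fromℤ-sum {suc n} f = trans (fromℤ-+ (f zero) _) (cong (fromℤ (f zero) ℚ.+_) (fromℤ-sum (f ∘ suc)))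

-- The class d H + a₁ E₁ + ⋯ + a_r E_r on ℙ² blown up at r points is the vector (d, a₁, …, a_r);
-- H² = 1, Eᵢ² = −1 and the classes are pairwise orthogonal.
η : Fin (suc r) → ℤ
η zero    = ℤ.1ℤ
η (suc _) = ℤ.-1ℤ

_·_ : Vector ℤ (suc r) → Vector ℤ (suc r) → ℤ
x · y = sumℤ (λ k → η k ℤ.* x k ℤ.* y k)

·-comm : (x y : Vector ℤ (suc r)) → x · y ≡ y · x
·-comm x y = sumℤ-cong (λ k → xy∙z≈xz∙y (η k) (x k) (y k))
  where open CommSemigroupProperties ℤ.*-commutativeSemigroup using (xy∙z≈xz∙y)

-·≡sumℚ : (x y : Vector ℤ (suc r)) →
          fromℤ (ℤ.- (x · y)) ≡ sumℚ (λ k → fromℤ (ℤ.- (η k ℤ.* y k)) ℚ.* fromℤ (x k))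
-·≡sumℚ x y = begin
  fromℤ (ℤ.- (x · y))
    ≡⟨ cong fromℤ (sym (ℤ.-1*i≡-i (x · y))) ⟩
  fromℤ (ℤ.-1ℤ ℤ.* (x · y))
    ≡⟨ cong fromℤ (*-distribˡ-sum ℤ.-1ℤ (λ k → η k ℤ.* x k ℤ.* y k)) ⟩
  fromℤ (sumℤ (λ k → ℤ.-1ℤ ℤ.* (η k ℤ.* x k ℤ.* y k)))
    ≡⟨ cong fromℤ (sumℤ-cong (λ k → rearrange (η k) (x k) (y k))) ⟩
  fromℤ (sumℤ (λ k → ℤ.- (η k ℤ.* y k) ℤ.* x k))
    ≡⟨ fromℤ-sum (λ k → ℤ.- (η k ℤ.* y k) ℤ.* x k) ⟩
  sumℚ (λ k → fromℤ (ℤ.- (η k ℤ.* y k) ℤ.* x k))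
    ≡⟨ sumℚ-cong (λ k → fromℤ-* (ℤ.- (η k ℤ.* y k)) (x k)) ⟩
  sumℚ (λ k → fromℤ (ℤ.- (η k ℤ.* y k)) ℚ.* fromℤ (x k))
    ∎
  where
  open ≡-Reasoning
  rearrange : ∀ e a b → ℤ.-1ℤ ℤ.* (e ℤ.* a ℤ.* b) ≡ ℤ.- (e ℤ.* b) ℤ.* a
  rearrange = solve 3 (λ e a b → con ℤ.-1ℤ :* (e :* a :* b) := :- (e :* b) :* a) refl
    where open ℤ.+-*-Solver

record ExceptionalCurves (m r : ℕ) : Set where
  field
    curve                 : Fin m → Vector ℤ (suc r)
    self-intersection     : ∀ s → curve s · curve s ≡ ℤ.-1ℤ
    distinct-intersection : ∀ s t → s ≢ t → curve s · curve t ≡ ℤ.0ℤ ⊎ curve s · curve t ≡ ℤ.1ℤ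

module _ (C : ExceptionalCurves m r) where
  open ExceptionalCurves C

  intersectionGraph : Graph m
  intersectionGraph = record
    { adj    = λ s t → does (curve s · curve t ℤ.≟ ℤ.1ℤ)
    ; sym    = λ s t → cong (λ z → does (z ℤ.≟ ℤ.1ℤ)) (·-comm (curve s) (curve t))
    ; irrefl = λ s → cong (λ z → does (z ℤ.≟ ℤ.1ℤ)) (self-intersection s)
    }

  idMinusAdj≡-· : ∀ s t → idMinusAdj intersectionGraph s t ≡ fromℤ (ℤ.- (curve s · curve t))
  idMinusAdj≡-· s t = case s ≟ t of λ where
      (yes refl) → trans (cong₂ ℚ._-_ (δ-refl s) (cong 𝟙 (Graph.irrefl intersectionGraph s)))
                         (sym (cong (fromℤ ∘ ℤ.-_) (self-intersection s)))
      (no s≢t)   → trans (cong (ℚ._- _) (δ-≢ s≢t)) (offDiagonal (distinct-intersection s t s≢t))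
    where
    offDiagonal : ∀ {z} → z ≡ ℤ.0ℤ ⊎ z ≡ ℤ.1ℤ → 0ℚ ℚ.- 𝟙 (does (z ℤ.≟ ℤ.1ℤ)) ≡ fromℤ (ℤ.- z)
    offDiagonal (inj₁ refl) = refl
    offDiagonal (inj₂ refl) = refl

  RankAtMost-idMinusAdj : RankAtMost (idMinusAdj intersectionGraph) (suc r)
  RankAtMost-idMinusAdj = (λ k s → fromℤ (curve s k)) , λ t →
    (λ k → fromℤ (ℤ.- (η k ℤ.* curve t k))) , λ s →
    trans (idMinusAdj≡-· s t) (-·≡sumℚ (curve s) (curve t))

module _ (curve : Fin m → Vector ℤ (suc r)) where

  self-intersection? : Dec (∀ s → curve s · curve s ≡ ℤ.-1ℤ)
  self-intersection? = all? λ s → curve s · curve s ℤ.≟ ℤ.-1ℤ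

  distinct-intersection? : Dec (∀ s t → s ≢ t → curve s · curve t ≡ ℤ.0ℤ ⊎ curve s · curve t ≡ ℤ.1ℤ)
  distinct-intersection? = all? λ s → all? λ t →
    ¬? (s ≟ t) →-dec (curve s · curve t ℤ.≟ ℤ.0ℤ ⊎-dec curve s · curve t ℤ.≟ ℤ.1ℤ)

basis : Fin r → Vector ℤ r
basis i k = if does (i ≟ k) then ℤ.1ℤ else ℤ.0ℤ

-- Eᵢ, the line H − Eᵢ − Eⱼ through pᵢ and pⱼ, the conic 2H − Σ_{k ≠ i} Eₖ through all points
-- but pᵢ, and the conic 2H − E₁ − ⋯ − E_r through all points.
exceptional : Fin r → Vector ℤ (suc r)
exceptional i = ℤ.0ℤ ◂ basis i

line : Fin r → Fin r → Vector ℤ (suc r)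
line i j = ℤ.1ℤ ◂ λ k → ℤ.- (basis i k ℤ.+ basis j k)

conicAvoiding : Fin r → Vector ℤ (suc r)
conicAvoiding i = ℤ.+ 2 ◂ λ k → basis i k ℤ.- ℤ.1ℤ

conicThroughAll : Vector ℤ (suc r)
conicThroughAll = ℤ.+ 2 ◂ λ _ → ℤ.-1ℤ

linesOnQuartic : Vec (Vector ℤ 6) 16
linesOnQuartic =
  exceptional 0F ∷ exceptional 1F ∷ exceptional 2F ∷ exceptional 3F ∷ exceptional 4F ∷
  line 0F 1F ∷ line 0F 2F ∷ line 0F 3F ∷ line 0F 4F ∷ line 1F 2F ∷
  line 1F 3F ∷ line 1F 4F ∷ line 2F 3F ∷ line 2F 4F ∷ line 3F 4F ∷
  conicThroughAll ∷ []

linesOnCubic : Vec (Vector ℤ 7) 27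
linesOnCubic =
  exceptional 0F ∷ exceptional 1F ∷ exceptional 2F ∷ exceptional 3F ∷ exceptional 4F ∷ exceptional 5F ∷
  conicAvoiding 0F ∷ conicAvoiding 1F ∷ conicAvoiding 2F ∷
  conicAvoiding 3F ∷ conicAvoiding 4F ∷ conicAvoiding 5F ∷
  line 0F 1F ∷ line 0F 2F ∷ line 0F 3F ∷ line 0F 4F ∷ line 0F 5F ∷ line 1F 2F ∷ line 1F 3F ∷ line 1F 4F ∷
  line 1F 5F ∷ line 2F 3F ∷ line 2F 4F ∷ line 2F 5F ∷ line 3F 4F ∷ line 3F 5F ∷ line 4F 5F ∷ []

quarticLines : ExceptionalCurves 16 5
quarticLines = record
  { curve                 = lookup linesOnQuartic
  ; self-intersection     = from-yes (self-intersection? (lookup linesOnQuartic))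
  ; distinct-intersection = from-yes (distinct-intersection? (lookup linesOnQuartic))
  }

cubicLines : ExceptionalCurves 27 6
cubicLines = record
  { curve                 = lookup linesOnCubic
  ; self-intersection     = from-yes (self-intersection? (lookup linesOnCubic))
  ; distinct-intersection = from-yes (distinct-intersection? (lookup linesOnCubic))
  }

clebsch : Graph 16
clebsch = intersectionGraph quarticLines

clebsch-triangleFree : CliqueNumberAtMost clebsch 2
clebsch-triangleFree = ¬HasClique⇒CliqueNumberAtMost clebsch (from-no (hasClique? clebsch 3 []))

schläfliComplement : Graph 27
schläfliComplement = intersectionGraph cubicLines

schläfliComplement-K₄Free : CliqueNumberAtMost schläfliComplement 3
schläfliComplement-K₄Free =
  ¬HasClique⇒CliqueNumberAtMost schläfliComplement (from-no (hasClique? schläfliComplement 4 []))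

-- The hypothesis 2 < l is only used through l ≥ 1.
corollary4p6 : ∀ (l : ℕ) → 2 < l →
    νAtMost 2 (16 * l) (6 * l + 10) × νAtMost 3 (27 * l) (7 * l + 20)
corollary4p6 (suc l) _ =
  subst (νAtMost 2 (16 * suc l)) (rearrange 6 10)
        (νAtMost-⊗K clebsch clebsch-triangleFree (RankAtMost-idMinusAdj quarticLines) l) ,
  subst (νAtMost 3 (27 * suc l)) (rearrange 7 20)
        (νAtMost-⊗K schläfliComplement schläfliComplement-K₄Free (RankAtMost-idMinusAdj cubicLines) l)
  where
  rearrange : ∀ r k → r + k + r * l ≡ r * suc l + k
  rearrange r k = solve 3 (λ r k l → r :+ k :+ r :* l := r :* (con 1 :+ l) :+ k) refl r k l
    where open ℕ.+-*-Solver
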